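{- For every graph $H$ and every $i\in\mathbb{N}$, $$c_f(H)\ge\frac{i-1}{i}\left(\mathsf{v}(H)-\frac{\alpha_i(H)}{2}\right).$$
   Context: All graphs are finite and simple; $\mathsf{d}(G)=\mathsf{e}(G)/\mathsf{v}(G)$; $\alpha_i(H)$ is the maximum $|X|$ over $X\subseteq V(H)$ with $\chi(H[X])\le i$. A jumbled model of $H$ in $G$ is a map $\mu$ from $V(H)$ to subsets of $V(G)$ such that each $G[\mu(v)]$ is connected (and nonempty) and for every edge $uv\in E(H)$ some edge of $G$ joins $\mu(u)$ and $\mu(v)$ (overlaps allowed); $\mu^{\#}(x)=|\{v:x\in\mu(v)\}|$. $\mathrm{Vol}_H(G)$ is the supremum of $\sum_j\alpha_j$ over finitely many reals $\alpha_j\ge0$ and jumbled models $\mu_j$ of $H$ in $G$ with $\sum_j\alpha_j\mu_j^{\#}(x)\le1$ for all $x\in V(G)$. The fractional extremal function is $c_f(H)=\sup_G\mathsf{d}(G)/\mathrm{Vol}_H(G)$ over non-null graphs $G$.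
   Formalization: The weights $\alpha_j$ in $\mathrm{Vol}_H(G)$ are rational rather than real, and the lower bound on $c_f(H)$ is checked only against rational thresholds below it. -}

module Defs where

open import Data.Nat as ℕ using (ℕ; zero; suc)
open import Data.Integer using (+_)
open import Data.Rational using (ℚ; _/_; _+_; _*_; _-_; _≤_; _<_; 0ℚ; 1ℚ)
open import Data.Bool using (Bool; true; false; T)
open import Data.Bool.Properties using (T?)
open import Data.Fin as Fin using (Fin)
open import Data.Fin.Properties using (_<?_)
open import Data.Fin.Subset using (Subset; _∈_; ∣_∣)
open import Data.Fin.Subset.Properties using (_∈?_)
open import Data.List using (List; []; _∷_; length; filter; allFin; map; concatMap)
open import Data.List.Relation.Unary.All using (All)
open import Data.Product using (Σ; ∃; ∃₂; _×_; _,_; proj₁; proj₂)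
open import Relation.Binary.PropositionalEquality using (_≡_; _≢_)
open import Relation.Nullary.Decidable using (_×-dec_)

record Graph : Set where
  field
    n      : ℕ
    adj    : Fin n → Fin n → Bool
    sym    : ∀ x y → adj x y ≡ adj y x
    irrefl : ∀ x → adj x x ≡ false
open Graph public

ℕtoℚ : ℕ → ℚ
ℕtoℚ k = + k / 1

-- a / b as a rational (only used with b ≥ 1; b = 0 gives junk value 0)
_÷ℕ_ : ℕ → ℕ → ℚ
a ÷ℕ zero    = 0ℚ
a ÷ℕ (suc b) = + a / suc b

vcount : Graph → ℕ
vcount G = n G

pairs : ∀ {A : Set} → List A → List (Σ A λ _ → A)
pairs xs = concatMap (λ x → map (λ y → x , y) xs) xs

ecount : Graph → ℕ
ecount G = length (filter (λ p → (proj₁ p <? proj₂ p) ×-dec T? (adj G (proj₁ p) (proj₂ p)))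
                          (pairs (allFin (n G))))

density : Graph → ℚ
density G = ecount G ÷ℕ vcount G

NonNull : Graph → Set
NonNull G = 1 ℕ.≤ n G

data Walk (G : Graph) (S : Subset (n G)) : Fin (n G) → Fin (n G) → Set where
  stop : ∀ {x} → Walk G S x x
  step : ∀ {x z y} → T (adj G x z) → z ∈ S → Walk G S z y → Walk G S x y

Connected : (G : Graph) → Subset (n G) → Set
Connected G S = (∃ λ x → x ∈ S) × (∀ x y → x ∈ S → y ∈ S → Walk G S x y)

record JumbledModel (H G : Graph) : Set where
  field
    μ     : Fin (n H) → Subset (n G)
    conn  : ∀ v → Connected G (μ v)
    edges : ∀ u v → T (adj H u v) →
            ∃₂ λ x y → x ∈ μ u × y ∈ μ v × T (adj G x y)
open JumbledModel public

mult : ∀ {H G} → JumbledModel H G → Fin (n G) → ℕ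
mult {H} m x = length (filter (λ v → x ∈? μ m v) (allFin (n H)))

Weighted : Graph → Graph → Set
Weighted H G = ℚ × JumbledModel H G

load : ∀ {H G} → List (Weighted H G) → Fin (n G) → ℚ
load []             x = 0ℚ
load ((α , m) ∷ ps) x = α * ℕtoℚ (mult m x) + load ps x

total : ∀ {H G} → List (Weighted H G) → ℚ
total []             = 0ℚ
total ((α , _) ∷ ps) = α + total ps

record Packing (H G : Graph) : Set where
  field
    models  : List (Weighted H G)
    nonneg  : All (λ p → 0ℚ ≤ proj₁ p) models
    capped  : ∀ x → load models x ≤ 1ℚ
open Packing public

-- Vol_H(G) ≤ v  (v is an upper bound for the supremum)
VolBoundedBy : Graph → Graph → ℚ → Set
VolBoundedBy H G v = ∀ (P : Packing H G) → total (models P) ≤ v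

-- c_f(H) ≥ r, i.e. sup_G d(G)/Vol_H(G) ≥ r: for every rational q with
-- 0 < q < r there is a non-null G with d(G)/Vol_H(G) > q, i.e. some v with
-- Vol_H(G) ≤ v and q·v < d(G).
CfAtLeast : Graph → ℚ → Set
CfAtLeast H r = ∀ (q : ℚ) → 0ℚ < q → q < r →
  ∃ λ (G : Graph) → NonNull G × ∃ λ (v : ℚ) → VolBoundedBy H G v × q * v < density G

ColourableOn : (H : Graph) → ℕ → Subset (n H) → Set
ColourableOn H i X =
  ∃ λ (c : (u : Fin (n H)) → u ∈ X → Fin i) →
    ∀ u v (pu : u ∈ X) (pv : v ∈ X) → T (adj H u v) → c u pu ≢ c v pv

IsAlpha : (H : Graph) → ℕ → ℕ → Set
IsAlpha H i a =
  (∃ λ X → ColourableOn H i X × ∣ X ∣ ≡ a) ×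
  (∀ X → ColourableOn H i X → ∣ X ∣ ℕ.≤ a)

-- Take G = K_i.  In a jumbled model of H in K_i, the vertices of H whose branch set is a single vertex
-- are properly i-coloured by that vertex (adjacent ones need adjacent, hence distinct, branch vertices),
-- so there are at most α_i(H) of them; every other branch set has at least two vertices.  Hence every
-- model has total multiplicity Σ_x μ#(x) ≥ 2 v(H) - α_i(H), and summing the capacity constraint over
-- the i vertices of K_i gives Vol_H(K_i) ≤ i / (2 v(H) - α_i(H)), to be compared with d(K_i) = (i - 1)/2.

module Submission where

open import Defs hiding (sym)
open import Data.Nat as ℕ using (ℕ; zero; suc; _≤_; _∸_; z≤n; s≤s; _≤?_)
import Data.Nat.Properties as ℕ
import Data.Integer as ℤ
import Data.Integer.Properties as ℤ
open import Data.Rational as ℚ using (ℚ; _+_; _*_; _-_; _<_; 0ℚ; 1ℚ; toℚᵘ; Positive)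
import Data.Rational.Properties as ℚ
open import Data.Rational.Unnormalised as ℚᵘ using (mkℚᵘ; *≡*) renaming (_≃_ to _≃ᵘ_)
import Data.Rational.Unnormalised.Properties as ℚᵘ
open import Data.Bool using (true; false; not; T; if_then_else_)
open import Data.Bool.Properties using (T?)
open import Data.Fin as Fin using (Fin; _≟_; _<?_)
import Data.Fin.Properties as Fin
open import Data.Fin.Subset using (Subset; _∈_; ∣_∣)
open import Data.Fin.Subset.Properties using (_∈?_; ∣p∣≤n; ∣p∣≤∣x∷p∣; ∣⁅x⁆∣≡1; x∈⁅y⁆⇒x≡y; p⊆q⇒∣p∣≤∣q∣)
open import Data.Vec using (_∷_; []; here; there)
open import Data.List using (List; []; _∷_; _++_; length; filter; tabulate; allFin; map; concatMap)
import Data.List.Properties as List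
import Data.Nat.ListAction as List
open import Data.List.Relation.Unary.All using (All; []; _∷_)
open import Data.Product using (Σ; _,_; proj₁; proj₂)
open import Function using (_∘_; id)
open import Function.Bundles using (mk⇔)
open import Relation.Binary.PropositionalEquality
open import Relation.Nullary using (Dec; _because_; yes; no; does; isYes)
open import Relation.Nullary.Decidable using (_×-dec_; does-⇔; dec-true; dec-false)
open import Relation.Nullary.Negation using (contradiction)
open import Relation.Unary using (Pred; Decidable)
open import Algebra.Properties.CommutativeMonoid.Sum ℕ.+-0-commutativeMonoid
  using (sum; sum-syntax; sum-cong-≗; ∑-comm; ∑-distrib-+)
open import Algebra.Properties.CommutativeMonoid.Sum ℚ.+-0-commutativeMonoid
  using () renaming (sum to sumℚ; ∑-distrib-+ to sumℚ-distrib-+; sum-replicate-zero to sumℚ-0)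

indicator : ∀ {p} {P : Set p} → Dec P → ℕ
indicator P? = if does P? then 1 else 0

∑-mono-≤ : ∀ {n} {f g : Fin n → ℕ} → (∀ x → f x ≤ g x) → sum f ≤ sum g
∑-mono-≤ {zero}  f≤g = z≤n
∑-mono-≤ {suc n} f≤g = ℕ.+-mono-≤ (f≤g Fin.zero) (∑-mono-≤ (f≤g ∘ Fin.suc))

∑-const : ∀ n k → ∑[ x < n ] k ≡ n ℕ.* k
∑-const zero    k = refl
∑-const (suc n) k = cong (k ℕ.+_) (∑-const n k)

sum-tabulate : ∀ {n} (f : Fin n → ℕ) → List.sum (tabulate f) ≡ sum f
sum-tabulate {zero}  f = refl
sum-tabulate {suc n} f = cong (f Fin.zero ℕ.+_) (sum-tabulate (f ∘ Fin.suc))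

length-filter-tabulate : ∀ {a p} {A : Set a} {P : Pred A p} (P? : Decidable P) {n} (f : Fin n → A) →
  length (filter P? (tabulate f)) ≡ ∑[ x < n ] indicator (P? (f x))
length-filter-tabulate P? {zero}  f = refl
length-filter-tabulate P? {suc n} f with P? (f Fin.zero)
... | true  because _ = cong suc (length-filter-tabulate P? (f ∘ Fin.suc))
... | false because _ = length-filter-tabulate P? (f ∘ Fin.suc)

length-filter-concatMap : ∀ {a b p} {A : Set a} {B : Set b} {P : Pred B p} (P? : Decidable P)
  (f : A → List B) (xs : List A) →
  length (filter P? (concatMap f xs)) ≡ List.sum (map (length ∘ filter P? ∘ f) xs)
length-filter-concatMap P? f []       = refl
length-filter-concatMap P? f (x ∷ xs) = begin
  length (filter P? (f x ++ concatMap f xs))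
    ≡⟨ cong length (List.filter-++ P? (f x) (concatMap f xs)) ⟩
  length (filter P? (f x) ++ filter P? (concatMap f xs))
    ≡⟨ List.length-++ (filter P? (f x)) ⟩
  length (filter P? (f x)) ℕ.+ length (filter P? (concatMap f xs))
    ≡⟨ cong (length (filter P? (f x)) ℕ.+_) (length-filter-concatMap P? f xs) ⟩
  List.sum (map (length ∘ filter P? ∘ f) (x ∷ xs)) ∎
  where open ≡-Reasoning

∣p∣≡∑ : ∀ {n} (p : Subset n) → ∣ p ∣ ≡ ∑[ x < n ] indicator (x ∈? p)
∣p∣≡∑ []          = refl
∣p∣≡∑ (true  ∷ p) = cong suc (∣p∣≡∑ p)
∣p∣≡∑ (false ∷ p) = ∣p∣≡∑ p

select : ∀ {n p} {P : Pred (Fin n) p} → Decidable P → Subset n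
select {zero}  P? = []
select {suc n} P? = isYes (P? Fin.zero) ∷ select (P? ∘ Fin.suc)

∈-select⁻ : ∀ {n p} {P : Pred (Fin n) p} (P? : Decidable P) {x} → x ∈ select P? → P x
∈-select⁻ P? {Fin.zero} x∈ with P? Fin.zero
... | yes px = px
∈-select⁻ P? {Fin.suc x} (there x∈) = ∈-select⁻ (P? ∘ Fin.suc) x∈

∣select∣≡∑ : ∀ {n p} {P : Pred (Fin n) p} (P? : Decidable P) → ∣ select P? ∣ ≡ ∑[ x < n ] indicator (P? x)
∣select∣≡∑ {zero}  P? = refl
∣select∣≡∑ {suc n} P? with P? Fin.zero
... | yes _ = cong suc (∣select∣≡∑ (P? ∘ Fin.suc))
... | no  _ = ∣select∣≡∑ (P? ∘ Fin.suc)

x∈p⇒1≤∣p∣ : ∀ {n} {x : Fin n} {p : Subset n} → x ∈ p → 1 ≤ ∣ p ∣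
x∈p⇒1≤∣p∣ {x = x} {p} x∈p = subst (_≤ ∣ p ∣) (∣⁅x⁆∣≡1 x)
  (p⊆q⇒∣p∣≤∣q∣ (λ y∈⁅x⁆ → subst (_∈ p) (sym (x∈⁅y⁆⇒x≡y x y∈⁅x⁆)) x∈p))

∣p∣≤1⇒∈-unique : ∀ {n} {x y : Fin n} {p : Subset n} → ∣ p ∣ ≤ 1 → x ∈ p → y ∈ p → x ≡ y
∣p∣≤1⇒∈-unique _           here      here      = refl
∣p∣≤1⇒∈-unique (s≤s ∣p∣≤0) here      (there y∈p) with () ← ℕ.≤-trans (x∈p⇒1≤∣p∣ y∈p) ∣p∣≤0
∣p∣≤1⇒∈-unique (s≤s ∣p∣≤0) (there x∈p) here      with () ← ℕ.≤-trans (x∈p⇒1≤∣p∣ x∈p) ∣p∣≤0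
∣p∣≤1⇒∈-unique {p = b ∷ p} ∣p∣≤1 (there x∈p) (there y∈p) =
  cong Fin.suc (∣p∣≤1⇒∈-unique (ℕ.≤-trans (∣p∣≤∣x∷p∣ b p) ∣p∣≤1) x∈p y∈p)

∑-mult≡∑∣μ∣ : ∀ {H G} (m : JumbledModel H G) → sum (mult m) ≡ ∑[ v < n H ] ∣ μ m v ∣
∑-mult≡∑∣μ∣ {H} {G} m = begin
  ∑[ x < n G ] mult m x
    ≡⟨ sum-cong-≗ (λ x → length-filter-tabulate (λ v → x ∈? μ m v) id) ⟩
  ∑[ x < n G ] ∑[ v < n H ] indicator (x ∈? μ m v)
    ≡⟨ ∑-comm (λ x v → indicator (x ∈? μ m v)) ⟩
  ∑[ v < n H ] ∑[ x < n G ] indicator (x ∈? μ m v)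
    ≡⟨ sum-cong-≗ (λ v → sym (∣p∣≡∑ (μ m v))) ⟩
  ∑[ v < n H ] ∣ μ m v ∣ ∎
  where open ≡-Reasoning

module _ {H G : Graph} (m : JumbledModel H G) where

  singletons : Subset (n H)
  singletons = select (λ v → ∣ μ m v ∣ ≤? 1)

  anchor : Fin (n H) → Fin (n G)
  anchor v = proj₁ (proj₁ (conn m v))

  anchor∈μ : ∀ v → anchor v ∈ μ m v
  anchor∈μ v = proj₂ (proj₁ (conn m v))

  singletons-colourable : ColourableOn H (n G) singletons
  singletons-colourable = (λ u _ → anchor u) , proper
    where
    proper : ∀ u v (u∈ : u ∈ singletons) (v∈ : v ∈ singletons) → T (adj H u v) → anchor u ≢ anchor v
    proper u v u∈ v∈ u~v anchor-u≡anchor-v with edges m u v u~v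
    ... | x , y , x∈μu , y∈μv , x~y = subst T (irrefl G y) (subst (λ z → T (adj G z y)) x≡y x~y)
      where
      x≡y : x ≡ y
      x≡y = trans (∣p∣≤1⇒∈-unique (∈-select⁻ _ u∈) x∈μu (anchor∈μ u))
           (trans anchor-u≡anchor-v (∣p∣≤1⇒∈-unique (∈-select⁻ _ v∈) (anchor∈μ v) y∈μv))

  2*v[H]≤∑∣μ∣+∣singletons∣ : 2 ℕ.* n H ≤ ∑[ v < n H ] ∣ μ m v ∣ ℕ.+ ∣ singletons ∣
  2*v[H]≤∑∣μ∣+∣singletons∣ = begin
    2 ℕ.* n H
      ≡⟨ ℕ.*-comm 2 (n H) ⟩
    n H ℕ.* 2
      ≡⟨ sym (∑-const (n H) 2) ⟩
    ∑[ v < n H ] 2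
      ≤⟨ ∑-mono-≤ (λ v → 2≤k+[k≤1] (x∈p⇒1≤∣p∣ (anchor∈μ v))) ⟩
    ∑[ v < n H ] (∣ μ m v ∣ ℕ.+ indicator (∣ μ m v ∣ ≤? 1))
      ≡⟨ ∑-distrib-+ (λ v → ∣ μ m v ∣) (λ v → indicator (∣ μ m v ∣ ≤? 1)) ⟩
    ∑[ v < n H ] ∣ μ m v ∣ ℕ.+ ∑[ v < n H ] indicator (∣ μ m v ∣ ≤? 1)
      ≡⟨ cong (∑[ v < n H ] ∣ μ m v ∣ ℕ.+_) (sym (∣select∣≡∑ (λ v → ∣ μ m v ∣ ≤? 1))) ⟩
    ∑[ v < n H ] ∣ μ m v ∣ ℕ.+ ∣ singletons ∣ ∎
    where
    open ℕ.≤-Reasoning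
    2≤k+[k≤1] : ∀ {k} → 1 ≤ k → 2 ≤ k ℕ.+ indicator (k ≤? 1)
    2≤k+[k≤1] {zero}        ()
    2≤k+[k≤1] {1}           _ = ℕ.≤-refl
    2≤k+[k≤1] {suc (suc k)} _ = s≤s (s≤s z≤n)

2*v[H]≤∑mult+α : ∀ {H G} (m : JumbledModel H G) {a} → IsAlpha H (n G) a →
                 2 ℕ.* n H ≤ sum (mult m) ℕ.+ a
2*v[H]≤∑mult+α {H} m {a} (_ , maximal) = begin
  2 ℕ.* n H
    ≤⟨ 2*v[H]≤∑∣μ∣+∣singletons∣ m ⟩
  ∑[ v < n H ] ∣ μ m v ∣ ℕ.+ ∣ singletons m ∣
    ≤⟨ ℕ.+-mono-≤ (ℕ.≤-reflexive (sym (∑-mult≡∑∣μ∣ m))) (maximal (singletons m) (singletons-colourable m)) ⟩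
  sum (mult m) ℕ.+ a ∎
  where open ℕ.≤-Reasoning

toℚᵘ-ℕtoℚ : ∀ k → toℚᵘ (ℕtoℚ k) ≃ᵘ mkℚᵘ (ℤ.+ k) 0
toℚᵘ-ℕtoℚ k = ℚ.toℚᵘ-fromℚᵘ (mkℚᵘ (ℤ.+ k) 0)

ℕtoℚ-suc : ∀ k → ℕtoℚ (suc k) ≡ 1ℚ + ℕtoℚ k
ℕtoℚ-suc k = ℚ.toℚᵘ-injective (begin
  toℚᵘ (ℕtoℚ (suc k))          ≈⟨ toℚᵘ-ℕtoℚ (suc k) ⟩
  mkℚᵘ (ℤ.+ suc k) 0           ≈⟨ *≡* (solve 1 (λ K → (one :+ K) :* one := (one :* one :+ K :* one) :* one) refl (ℤ.+ k)) ⟩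
  ℚᵘ.1ℚᵘ ℚᵘ.+ mkℚᵘ (ℤ.+ k) 0   ≈⟨ ℚᵘ.+-congʳ ℚᵘ.1ℚᵘ (ℚᵘ.≃-sym (toℚᵘ-ℕtoℚ k)) ⟩
  toℚᵘ 1ℚ ℚᵘ.+ toℚᵘ (ℕtoℚ k)   ≈⟨ ℚᵘ.≃-sym (ℚ.toℚᵘ-homo-+ 1ℚ (ℕtoℚ k)) ⟩
  toℚᵘ (1ℚ + ℕtoℚ k)           ∎)
  where
  open import Relation.Binary.Reasoning.Setoid ℚᵘ.≃-setoid
  open import Data.Integer.Solver using (module +-*-Solver)
  open +-*-Solver
  one = con (ℤ.+ 1)

ℕtoℚ-+ : ∀ m n → ℕtoℚ (m ℕ.+ n) ≡ ℕtoℚ m + ℕtoℚ n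
ℕtoℚ-+ zero    n = sym (ℚ.+-identityˡ (ℕtoℚ n))
ℕtoℚ-+ (suc m) n = begin
  ℕtoℚ (suc (m ℕ.+ n))          ≡⟨ ℕtoℚ-suc (m ℕ.+ n) ⟩
  1ℚ + ℕtoℚ (m ℕ.+ n)           ≡⟨ cong (1ℚ +_) (ℕtoℚ-+ m n) ⟩
  1ℚ + (ℕtoℚ m + ℕtoℚ n)        ≡⟨ sym (ℚ.+-assoc 1ℚ (ℕtoℚ m) (ℕtoℚ n)) ⟩
  (1ℚ + ℕtoℚ m) + ℕtoℚ n        ≡⟨ cong (_+ ℕtoℚ n) (sym (ℕtoℚ-suc m)) ⟩
  ℕtoℚ (suc m) + ℕtoℚ n         ∎
  where open ≡-Reasoning

ℕtoℚ-* : ∀ m n → ℕtoℚ (m ℕ.* n) ≡ ℕtoℚ m * ℕtoℚ n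
ℕtoℚ-* zero    n = sym (ℚ.*-zeroˡ (ℕtoℚ n))
ℕtoℚ-* (suc m) n = begin
  ℕtoℚ (n ℕ.+ m ℕ.* n)              ≡⟨ ℕtoℚ-+ n (m ℕ.* n) ⟩
  ℕtoℚ n + ℕtoℚ (m ℕ.* n)           ≡⟨ cong₂ _+_ (sym (ℚ.*-identityˡ (ℕtoℚ n))) (ℕtoℚ-* m n) ⟩
  1ℚ * ℕtoℚ n + ℕtoℚ m * ℕtoℚ n     ≡⟨ sym (ℚ.*-distribʳ-+ (ℕtoℚ n) 1ℚ (ℕtoℚ m)) ⟩
  (1ℚ + ℕtoℚ m) * ℕtoℚ n            ≡⟨ cong (_* ℕtoℚ n) (sym (ℕtoℚ-suc m)) ⟩
  ℕtoℚ (suc m) * ℕtoℚ n             ∎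
  where open ≡-Reasoning

ℕtoℚ-mono-≤ : ∀ {m n} → m ≤ n → ℕtoℚ m ℚ.≤ ℕtoℚ n
ℕtoℚ-mono-≤ {n = n} z≤n = ℚ.nonNegative⁻¹ (ℕtoℚ n) {{ℚ.normalize-nonNeg n 1}}
ℕtoℚ-mono-≤ {suc m} {suc n} (s≤s m≤n) = begin
  ℕtoℚ (suc m)     ≡⟨ ℕtoℚ-suc m ⟩
  1ℚ + ℕtoℚ m      ≤⟨ ℚ.+-monoʳ-≤ 1ℚ (ℕtoℚ-mono-≤ m≤n) ⟩
  1ℚ + ℕtoℚ n      ≡⟨ sym (ℕtoℚ-suc n) ⟩
  ℕtoℚ (suc n)     ∎
  where open ℚ.≤-Reasoning

ℕtoℚ-suc-positive : ∀ k → Positive (ℕtoℚ (suc k))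
ℕtoℚ-suc-positive k = ℚ.normalize-pos (suc k) 1

÷ℕ-positive : ∀ a b → Positive (suc a ÷ℕ suc b)
÷ℕ-positive a b = ℚ.normalize-pos (suc a) (suc b)

÷ℕ-*-cancel : ∀ a b → (a ÷ℕ suc b) * ℕtoℚ (suc b) ≡ ℕtoℚ a
÷ℕ-*-cancel a b = ℚ.toℚᵘ-injective (begin
  toℚᵘ ((a ÷ℕ suc b) * ℕtoℚ (suc b))           ≈⟨ ℚ.toℚᵘ-homo-* (a ÷ℕ suc b) (ℕtoℚ (suc b)) ⟩
  toℚᵘ (a ÷ℕ suc b) ℚᵘ.* toℚᵘ (ℕtoℚ (suc b))   ≈⟨ ℚᵘ.*-cong (ℚ.toℚᵘ-fromℚᵘ (mkℚᵘ (ℤ.+ a) b)) (toℚᵘ-ℕtoℚ (suc b)) ⟩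
  mkℚᵘ (ℤ.+ a) b ℚᵘ.* mkℚᵘ (ℤ.+ suc b) 0       ≈⟨ *≡* (ℤ.*-assoc (ℤ.+ a) (ℤ.+ suc b) (ℤ.+ 1)) ⟩
  mkℚᵘ (ℤ.+ a) 0                               ≈⟨ ℚᵘ.≃-sym (toℚᵘ-ℕtoℚ a) ⟩
  toℚᵘ (ℕtoℚ a)                                ∎)
  where open import Relation.Binary.Reasoning.Setoid ℚᵘ.≃-setoid

*-cancelʳ-≡ : ∀ {p q} r .{{_ : Positive r}} → p * r ≡ q * r → p ≡ q
*-cancelʳ-≡ r pr≡qr =
  ℚ.≤-antisym (ℚ.*-cancelʳ-≤-pos r (ℚ.≤-reflexive pr≡qr)) (ℚ.*-cancelʳ-≤-pos r (ℚ.≤-reflexive (sym pr≡qr)))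

*≡⇒≡÷ℕ : ∀ {x} a b → x * ℕtoℚ (suc b) ≡ ℕtoℚ a → x ≡ a ÷ℕ suc b
*≡⇒≡÷ℕ a b x*b≡a =
  *-cancelʳ-≡ (ℕtoℚ (suc b)) {{ℕtoℚ-suc-positive b}} (trans x*b≡a (sym (÷ℕ-*-cancel a b)))

*≤⇒≤÷ℕ : ∀ {x} a b → x * ℕtoℚ (suc b) ℚ.≤ ℕtoℚ a → x ℚ.≤ a ÷ℕ suc b
*≤⇒≤÷ℕ a b x*b≤a =
  ℚ.*-cancelʳ-≤-pos (ℕtoℚ (suc b)) {{ℕtoℚ-suc-positive b}} (ℚ.≤-trans x*b≤a (ℚ.≤-reflexive (sym (÷ℕ-*-cancel a b))))

sumℚ-mono-≤ : ∀ {n} {f g : Fin n → ℚ} → (∀ x → f x ℚ.≤ g x) → sumℚ f ℚ.≤ sumℚ g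
sumℚ-mono-≤ {zero}  f≤g = ℚ.≤-refl
sumℚ-mono-≤ {suc n} f≤g = ℚ.+-mono-≤ (f≤g Fin.zero) (sumℚ-mono-≤ (f≤g ∘ Fin.suc))

sumℚ-1 : ∀ n → sumℚ {n} (λ _ → 1ℚ) ≡ ℕtoℚ n
sumℚ-1 zero    = refl
sumℚ-1 (suc n) = trans (cong (1ℚ +_) (sumℚ-1 n)) (sym (ℕtoℚ-suc n))

sumℚ-*-ℕtoℚ : ∀ {n} α (f : Fin n → ℕ) → sumℚ (λ x → α * ℕtoℚ (f x)) ≡ α * ℕtoℚ (sum f)
sumℚ-*-ℕtoℚ {zero}  α f = sym (ℚ.*-zeroʳ α)
sumℚ-*-ℕtoℚ {suc n} α f = begin
  α * ℕtoℚ f₀ + sumℚ (λ x → α * ℕtoℚ (f (Fin.suc x)))   ≡⟨ cong (α * ℕtoℚ f₀ +_) (sumℚ-*-ℕtoℚ α (f ∘ Fin.suc)) ⟩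
  α * ℕtoℚ f₀ + α * ℕtoℚ ∑f′                             ≡⟨ sym (ℚ.*-distribˡ-+ α (ℕtoℚ f₀) (ℕtoℚ ∑f′)) ⟩
  α * (ℕtoℚ f₀ + ℕtoℚ ∑f′)                               ≡⟨ cong (α *_) (sym (ℕtoℚ-+ f₀ ∑f′)) ⟩
  α * ℕtoℚ (sum f)                                        ∎
  where
  open ≡-Reasoning
  f₀ = f Fin.zero
  ∑f′ = sum (f ∘ Fin.suc)

module _ {H G : Graph} (D : ℕ) (D≤weight : ∀ (m : JumbledModel H G) → D ≤ sum (mult m)) where

  total*D≤∑load : ∀ ps → All (λ p → 0ℚ ℚ.≤ proj₁ p) ps → total ps * ℕtoℚ D ℚ.≤ sumℚ (load ps)
  total*D≤∑load []             []           = ℚ.≤-reflexive (trans (ℚ.*-zeroˡ (ℕtoℚ D)) (sym (sumℚ-0 (n G))))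
  total*D≤∑load ((α , m) ∷ ps) (0≤α ∷ 0≤ps) = begin
    (α + total ps) * ℕtoℚ D
      ≡⟨ ℚ.*-distribʳ-+ (ℕtoℚ D) α (total ps) ⟩
    α * ℕtoℚ D + total ps * ℕtoℚ D
      ≤⟨ ℚ.+-mono-≤ (ℚ.*-monoˡ-≤-nonNeg α {{ℚ.nonNegative 0≤α}} (ℕtoℚ-mono-≤ (D≤weight m))) (total*D≤∑load ps 0≤ps) ⟩
    α * ℕtoℚ (sum (mult m)) + sumℚ (load ps)
      ≡⟨ cong (_+ sumℚ (load ps)) (sym (sumℚ-*-ℕtoℚ α (mult m))) ⟩
    sumℚ (λ x → α * ℕtoℚ (mult m x)) + sumℚ (load ps)
      ≡⟨ sym (sumℚ-distrib-+ (λ x → α * ℕtoℚ (mult m x)) (load ps)) ⟩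
    sumℚ (load ((α , m) ∷ ps)) ∎
    where open ℚ.≤-Reasoning

  packing-total*D≤v[G] : (P : Packing H G) → total (models P) * ℕtoℚ D ℚ.≤ ℕtoℚ (n G)
  packing-total*D≤v[G] P = begin
    total (models P) * ℕtoℚ D     ≤⟨ total*D≤∑load (models P) (nonneg P) ⟩
    sumℚ (load (models P))        ≤⟨ sumℚ-mono-≤ (capped P) ⟩
    sumℚ {n G} (λ _ → 1ℚ)         ≡⟨ sumℚ-1 (n G) ⟩
    ℕtoℚ (n G)                    ∎
    where open ℚ.≤-Reasoning

volBoundedBy-÷ℕ : ∀ {H G} d → (∀ (m : JumbledModel H G) → suc d ≤ sum (mult m)) →
                  VolBoundedBy H G (n G ÷ℕ suc d)
volBoundedBy-÷ℕ {G = G} d d<weight P = *≤⇒≤÷ℕ (n G) d (packing-total*D≤v[G] (suc d) d<weight P)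

complete : ℕ → Graph
complete k = record { n = k ; adj = λ x y → not (does (x ≟ y)) ; sym = adj-sym ; irrefl = adj-irrefl }
  where
  adj-sym : ∀ (x y : Fin k) → not (does (x ≟ y)) ≡ not (does (y ≟ x))
  adj-sym x y = cong not (does-⇔ (mk⇔ sym sym) (x ≟ y) (y ≟ x))
  adj-irrefl : ∀ (x : Fin k) → not (does (x ≟ x)) ≡ false
  adj-irrefl x = cong not (dec-true (x ≟ x) refl)

ecount≡∑∑ : ∀ G → ecount G ≡ ∑[ x < n G ] ∑[ y < n G ] indicator ((x <? y) ×-dec T? (adj G x y))
ecount≡∑∑ G = begin
  length (filter P? (concatMap (λ x → map (x ,_) (allFin (n G))) (allFin (n G))))
    ≡⟨ length-filter-concatMap P? (λ x → map (x ,_) (allFin (n G))) (allFin (n G)) ⟩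
  List.sum (map row (allFin (n G)))
    ≡⟨ cong List.sum (List.map-tabulate id row) ⟩
  List.sum (tabulate row)
    ≡⟨ sum-tabulate row ⟩
  ∑[ x < n G ] length (filter P? (map (x ,_) (allFin (n G))))
    ≡⟨ sum-cong-≗ (λ x → cong (length ∘ filter P?) (List.map-tabulate id (x ,_))) ⟩
  ∑[ x < n G ] length (filter P? (tabulate (x ,_)))
    ≡⟨ sum-cong-≗ (λ x → length-filter-tabulate P? (x ,_)) ⟩
  ∑[ x < n G ] ∑[ y < n G ] indicator ((x <? y) ×-dec T? (adj G x y)) ∎
  where
  open ≡-Reasoning
  P? : (p : Σ (Fin (n G)) (λ _ → Fin (n G))) → Dec _
  P? (x , y) = (x <? y) ×-dec T? (adj G x y)
  row : Fin (n G) → ℕ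
  row x = length (filter P? (map (x ,_) (allFin (n G))))

lessPairs : ℕ → ℕ
lessPairs k = ∑[ x < k ] ∑[ y < k ] indicator (x <? y)

lessPairs-suc : ∀ k → lessPairs (suc k) ℕ.* 2 ≡ k ℕ.* suc k
lessPairs-suc zero    = refl
lessPairs-suc (suc k) = begin
  (∑[ y < suc k ] 1 ℕ.+ lessPairs (suc k)) ℕ.* 2
    ≡⟨ cong (λ t → (t ℕ.+ lessPairs (suc k)) ℕ.* 2) (trans (∑-const (suc k) 1) (ℕ.*-identityʳ (suc k))) ⟩
  (suc k ℕ.+ lessPairs (suc k)) ℕ.* 2
    ≡⟨ ℕ.*-distribʳ-+ 2 (suc k) (lessPairs (suc k)) ⟩
  suc k ℕ.* 2 ℕ.+ lessPairs (suc k) ℕ.* 2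
    ≡⟨ cong (suc k ℕ.* 2 ℕ.+_) (lessPairs-suc k) ⟩
  suc k ℕ.* 2 ℕ.+ k ℕ.* suc k
    ≡⟨ solve 1 (λ k → (con 1 :+ k) :* con 2 :+ k :* (con 1 :+ k) := (con 1 :+ k) :* (con 2 :+ k)) refl k ⟩
  suc k ℕ.* suc (suc k) ∎
  where
  open ≡-Reasoning
  open import Data.Nat.Solver using (module +-*-Solver)
  open +-*-Solver

ecount-complete : ∀ k → ecount (complete k) ≡ lessPairs k
ecount-complete k = trans (ecount≡∑∑ (complete k)) (sum-cong-≗ (λ x → sum-cong-≗ ([x<y∧x~y]≡[x<y] x)))
  where
  x<y⇒x~y : ∀ {x y} → x Fin.< y → T (adj (complete k) x y)
  x<y⇒x~y {x} {y} x<y = subst (T ∘ not) (sym (dec-false (x ≟ y) (Fin.<⇒≢ x<y))) _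
  [x<y∧x~y]≡[x<y] : ∀ x y → indicator ((x <? y) ×-dec T? (adj (complete k) x y)) ≡ indicator (x <? y)
  [x<y∧x~y]≡[x<y] x y = cong (if_then 1 else 0)
    (does-⇔ (mk⇔ proj₁ (λ x<y → x<y , x<y⇒x~y x<y)) ((x <? y) ×-dec T? (adj (complete k) x y)) (x <? y))

density-complete : ∀ k → density (complete (suc k)) ≡ k ÷ℕ 2
density-complete k = *≡⇒≡÷ℕ {x} k 1 (*-cancelʳ-≡ (ℕtoℚ (suc k)) {{ℕtoℚ-suc-positive k}} (begin
  x * ℕtoℚ 2 * ℕtoℚ (suc k)            ≡⟨ solve 3 (λ x t i → x :* t :* i := x :* i :* t) refl x (ℕtoℚ 2) (ℕtoℚ (suc k)) ⟩
  x * ℕtoℚ (suc k) * ℕtoℚ 2            ≡⟨ cong (_* ℕtoℚ 2) (÷ℕ-*-cancel E k) ⟩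
  ℕtoℚ E * ℕtoℚ 2                      ≡⟨ sym (ℕtoℚ-* E 2) ⟩
  ℕtoℚ (E ℕ.* 2)                       ≡⟨ cong ℕtoℚ (trans (cong (ℕ._* 2) (ecount-complete (suc k))) (lessPairs-suc k)) ⟩
  ℕtoℚ (k ℕ.* suc k)                   ≡⟨ ℕtoℚ-* k (suc k) ⟩
  ℕtoℚ k * ℕtoℚ (suc k)                ∎))
  where
  open ≡-Reasoning
  open import Data.Rational.Solver using (module +-*-Solver)
  open +-*-Solver
  E = ecount (complete (suc k))
  x = E ÷ℕ suc k

bound*volume≡density : ∀ i' N a d → suc d ℕ.+ a ≡ 2 ℕ.* N →
  ((i' ÷ℕ suc i') * (ℕtoℚ N - a ÷ℕ 2)) * (suc i' ÷ℕ suc d) ≡ i' ÷ℕ 2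
bound*volume≡density i' N a d D+a≡2N = *≡⇒≡÷ℕ i' 1 (begin
  u * (ℕtoℚ N - w) * v * ℕtoℚ 2
    ≡⟨ solve 5 (λ u n w v t → u :* (n :- w) :* v :* t := u :* (t :* n :- w :* t) :* v) refl u (ℕtoℚ N) w v (ℕtoℚ 2) ⟩
  u * (ℕtoℚ 2 * ℕtoℚ N - w * ℕtoℚ 2) * v
    ≡⟨ cong₂ (λ s t → u * (s - t) * v) 2N≡D+a (÷ℕ-*-cancel a 1) ⟩
  u * ((ℕtoℚ (suc d) + ℕtoℚ a) - ℕtoℚ a) * v
    ≡⟨ solve 4 (λ u D a v → u :* ((D :+ a) :- a) :* v := u :* (v :* D)) refl u (ℕtoℚ (suc d)) (ℕtoℚ a) v ⟩
  u * (v * ℕtoℚ (suc d))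
    ≡⟨ cong (u *_) (÷ℕ-*-cancel (suc i') d) ⟩
  u * ℕtoℚ (suc i')
    ≡⟨ ÷ℕ-*-cancel i' i' ⟩
  ℕtoℚ i' ∎)
  where
  open ≡-Reasoning
  open import Data.Rational.Solver using (module +-*-Solver)
  open +-*-Solver
  u = i' ÷ℕ suc i'
  w = a ÷ℕ 2
  v = suc i' ÷ℕ suc d
  2N≡D+a : ℕtoℚ 2 * ℕtoℚ N ≡ ℕtoℚ (suc d) + ℕtoℚ a
  2N≡D+a = trans (sym (ℕtoℚ-* 2 N)) (trans (cong ℕtoℚ (sym D+a≡2N)) (ℕtoℚ-+ (suc d) a))

n+[n∸a]+a≡2*n : ∀ {a n} → a ≤ n → n ℕ.+ (n ∸ a) ℕ.+ a ≡ 2 ℕ.* n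
n+[n∸a]+a≡2*n {a} {n} a≤n = begin
  n ℕ.+ (n ∸ a) ℕ.+ a    ≡⟨ ℕ.+-assoc n (n ∸ a) a ⟩
  n ℕ.+ (n ∸ a ℕ.+ a)    ≡⟨ cong (n ℕ.+_) (ℕ.m∸n+n≡m a≤n) ⟩
  n ℕ.+ n                ≡⟨ cong (n ℕ.+_) (sym (ℕ.+-identityʳ n)) ⟩
  2 ℕ.* n                ∎
  where open ≡-Reasoning

IsAlpha⇒a≤v[H] : ∀ {H i a} → IsAlpha H i a → a ≤ n H
IsAlpha⇒a≤v[H] ((X , _ , ∣X∣≡a) , _) = subst (_≤ _) ∣X∣≡a (∣p∣≤n X)

lemma2p4 : (H : Graph) (i : ℕ) → 1 ≤ i → (a : ℕ) → IsAlpha H i a →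
           CfAtLeast H (((i ∸ 1) ÷ℕ i) * (ℕtoℚ (n H) - (a ÷ℕ 2)))
lemma2p4 H (suc i') _ a α q 0<q q<r with n H in v[H]≡ | IsAlpha⇒a≤v[H] {H} {suc i'} α
... | zero  | z≤n = contradiction (subst (q <_) (ℚ.*-zeroʳ (i' ÷ℕ suc i')) q<r) (ℚ.<-asym 0<q)
... | suc N | a≤v[H] = complete (suc i') , s≤s z≤n , v , volBoundedBy-÷ℕ d D≤weight , q*v<density
  where
  -- suc d = 2 v(H) - α_i(H)
  d = N ℕ.+ (suc N ∸ a)
  D+a≡2v[H] : suc d ℕ.+ a ≡ 2 ℕ.* suc N
  D+a≡2v[H] = n+[n∸a]+a≡2*n a≤v[H]
  v = suc i' ÷ℕ suc d
  D≤weight : ∀ m → suc d ≤ sum (mult m)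
  D≤weight m = ℕ.+-cancelʳ-≤ a (suc d) (sum (mult m))
    (subst (_≤ sum (mult m) ℕ.+ a) (trans (cong (2 ℕ.*_) v[H]≡) (sym D+a≡2v[H])) (2*v[H]≤∑mult+α m α))
  q*v<density : q * v < density (complete (suc i'))
  q*v<density = begin-strict
    q * v                                          <⟨ ℚ.*-monoˡ-<-pos v {{÷ℕ-positive i' d}} q<r ⟩
    (i' ÷ℕ suc i') * (ℕtoℚ (suc N) - a ÷ℕ 2) * v   ≡⟨ bound*volume≡density i' (suc N) a d D+a≡2v[H] ⟩
    i' ÷ℕ 2                                        ≡⟨ sym (density-complete i') ⟩
    density (complete (suc i'))                    ∎
    where open ℚ.≤-Reasoning
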